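{- If $(A,\rightarrow,\rightsquigarrow,1)$ is a commutative pseudo-BE algebra, then the sets of internal states of type I and of type II on $A$ coincide: $\mathcal{IS}^{(I)}(A)=\mathcal{IS}^{(II)}(A)$. The converse fails: there exists a pseudo-BE algebra $A$ that is not commutative but satisfies $\mathcal{IS}^{(I)}(A)=\mathcal{IS}^{(II)}(A)$.
   Context: A pseudo-BE algebra is an algebra $(A,\rightarrow,\rightsquigarrow,1)$ of type $(2,2,0)$ such that for all $x,y,z\in A$: $x\rightarrow x=x\rightsquigarrow x=1$; $x\rightarrow 1=x\rightsquigarrow 1=1$; $1\rightarrow x=1\rightsquigarrow x=x$; $x\rightarrow(y\rightsquigarrow z)=y\rightsquigarrow(x\rightarrow z)$; $x\rightarrow y=1$ iff $x\rightsquigarrow y=1$. Write $x\le y$ iff $x\rightarrow y=1$, $x\vee_1 y=(x\rightarrow y)\rightsquigarrow y$, $x\vee_2 y=(x\rightsquigarrow y)\rightarrow y$. $A$ is commutative if $x\vee_1 y=y\vee_1 x$ and $x\vee_2 y=y\vee_2 x$ for all $x,y$. For $\mu:A\to A$ consider: (is1) $x\le y$ implies $\mu(x)\le\mu(y)$; (is2) $\mu(x\rightarrow y)=\mu(x\vee_1 y)\rightarrow\mu(y)$ and $\mu(x\rightsquigarrow y)=\mu(x\vee_2 y)\rightsquigarrow\mu(y)$; (is2') $\mu(x\rightarrow y)=\mu(y\vee_1 x)\rightarrow\mu(y)$ and $\mu(x\rightsquigarrow y)=\mu(y\vee_2 x)\rightsquigarrow\mu(y)$; (is3) $\mu(\mu(x)\rightarrow\mu(y))=\mu(x)\rightarrow\mu(y)$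 and $\mu(\mu(x)\rightsquigarrow\mu(y))=\mu(x)\rightsquigarrow\mu(y)$, all for all $x,y$. $\mathcal{IS}^{(I)}(A)$ is the set of $\mu$ satisfying (is1),(is2),(is3); $\mathcal{IS}^{(II)}(A)$ the set of $\mu$ satisfying (is1),(is2'),(is3). -}

module Defs where

open import Data.Product using (_×_; Σ)
open import Relation.Binary.PropositionalEquality using (_≡_)
open import Relation.Nullary using (¬_)
open import Function.Bundles using (_⇔_)

record PseudoBE : Set₁ where
  infixr 5 _⇒_ _⇝_
  field
    Carrier : Set
    _⇒_     : Carrier → Carrier → Carrier
    _⇝_     : Carrier → Carrier → Carrier
    one     : Carrier
    refl⇒   : ∀ x → x ⇒ x ≡ one
    refl⇝   : ∀ x → x ⇝ x ≡ one
    top⇒    : ∀ x → x ⇒ one ≡ one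
    top⇝    : ∀ x → x ⇝ one ≡ one
    left⇒   : ∀ x → one ⇒ x ≡ x
    left⇝   : ∀ x → one ⇝ x ≡ x
    exch    : ∀ x y z → x ⇒ (y ⇝ z) ≡ y ⇝ (x ⇒ z)
    one⇒⇝   : ∀ x y → x ⇒ y ≡ one → x ⇝ y ≡ one
    one⇝⇒   : ∀ x y → x ⇝ y ≡ one → x ⇒ y ≡ one

  _≤_ : Carrier → Carrier → Set
  x ≤ y = x ⇒ y ≡ one

  _∨₁_ : Carrier → Carrier → Carrier
  x ∨₁ y = (x ⇒ y) ⇝ y

  _∨₂_ : Carrier → Carrier → Carrier
  x ∨₂ y = (x ⇝ y) ⇒ y

module _ (A : PseudoBE) where
  open PseudoBE A

  Commutative : Set
  Commutative = (∀ x y → x ∨₁ y ≡ y ∨₁ x) × (∀ x y → x ∨₂ y ≡ y ∨₂ x)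

  IS1 : (Carrier → Carrier) → Set
  IS1 μ = ∀ x y → x ≤ y → μ x ≤ μ y

  IS2 : (Carrier → Carrier) → Set
  IS2 μ = ∀ x y → (μ (x ⇒ y) ≡ μ (x ∨₁ y) ⇒ μ y) × (μ (x ⇝ y) ≡ μ (x ∨₂ y) ⇝ μ y)

  IS2′ : (Carrier → Carrier) → Set
  IS2′ μ = ∀ x y → (μ (x ⇒ y) ≡ μ (y ∨₁ x) ⇒ μ y) × (μ (x ⇝ y) ≡ μ (y ∨₂ x) ⇝ μ y)

  IS3 : (Carrier → Carrier) → Set
  IS3 μ = ∀ x y → (μ (μ x ⇒ μ y) ≡ μ x ⇒ μ y) × (μ (μ x ⇝ μ y) ≡ μ x ⇝ μ y)

  IsStateI : (Carrier → Carrier) → Set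
  IsStateI μ = IS1 μ × IS2 μ × IS3 μ

  IsStateII : (Carrier → Carrier) → Set
  IsStateII μ = IS1 μ × IS2′ μ × IS3 μ

  SameStates : Set
  SameStates = ∀ (μ : Carrier → Carrier) → IsStateI μ ⇔ IsStateII μ

-- The axioms (is2) and (is2′) differ only in the antecedent of the
-- implication on the right: (is2) uses μ (x ∨ y) where (is2′) uses
-- μ (y ∨ x).  So the two classes of internal states coincide as soon as
-- every monotone μ is "join-symmetric": μ (x ∨ y) and μ (y ∨ x) give the
-- same implication into μ y.
module Submission where

open import Defs
open import Data.Product using (_×_; Σ; _,_; proj₁; proj₂)
open import Relation.Nullary using (¬_)
open import Relation.Binary.PropositionalEquality
  using (_≡_; refl; sym; trans; cong)
open import Function.Bundles using (_⇔_; mk⇔; Equivalence)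

module _ (A : PseudoBE) where
  open PseudoBE A

  JoinSymmetric : (Carrier → Carrier) → Set
  JoinSymmetric μ = ∀ x y →
    (μ (x ∨₁ y) ⇒ μ y ≡ μ (y ∨₁ x) ⇒ μ y) ×
    (μ (x ∨₂ y) ⇝ μ y ≡ μ (y ∨₂ x) ⇝ μ y)

  IS2⇔IS2′ : ∀ {μ} → JoinSymmetric μ → IS2 A μ ⇔ IS2′ A μ
  IS2⇔IS2′ {μ} sym∨ = mk⇔ to from
    where
    to : IS2 A μ → IS2′ A μ
    to is2 x y = trans (proj₁ (is2 x y)) (proj₁ (sym∨ x y))
               , trans (proj₂ (is2 x y)) (proj₂ (sym∨ x y))
    from : IS2′ A μ → IS2 A μ
    from is2′ x y = trans (proj₁ (is2′ x y)) (sym (proj₁ (sym∨ x y)))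
                  , trans (proj₂ (is2′ x y)) (sym (proj₂ (sym∨ x y)))

  -- If every monotone map is join-symmetric, then IS^(I)(A) = IS^(II)(A);
  -- monotonicity (is1) is part of both definitions, so it may be assumed.
  sameStates-from-joinSymmetric :
    (∀ μ → IS1 A μ → JoinSymmetric μ) → SameStates A
  sameStates-from-joinSymmetric sym∨ μ = mk⇔ to from
    where
    to : IsStateI A μ → IsStateII A μ
    to (is1 , is2 , is3) =
      is1 , Equivalence.to (IS2⇔IS2′ (sym∨ μ is1)) is2 , is3
    from : IsStateII A μ → IsStateI A μ
    from (is1 , is2′ , is3) =
      is1 , Equivalence.from (IS2⇔IS2′ (sym∨ μ is1)) is2′ , is3

  commutative⇒joinSymmetric : Commutative A → ∀ μ → JoinSymmetric μ
  commutative⇒joinSymmetric (comm₁ , comm₂) μ x y =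
    cong (λ t → μ t ⇒ μ y) (comm₁ x y) , cong (λ t → μ t ⇝ μ y) (comm₂ x y)

data Three : Set where
  top a b : Three

imp : Three → Three → Three
imp top y = y
imp a   y = top
imp b   y = top

imp-refl : ∀ x → imp x x ≡ top
imp-refl top = refl
imp-refl a   = refl
imp-refl b   = refl

imp-top : ∀ x → imp x top ≡ top
imp-top top = refl
imp-top a   = refl
imp-top b   = refl

imp-exch : ∀ x y z → imp x (imp y z) ≡ imp y (imp x z)
imp-exch top y   z = refl
imp-exch a   top z = refl
imp-exch a   a   z = refl
imp-exch a   b   z = refl
imp-exch b   top z = refl
imp-exch b   a   z = refl
imp-exch b   b   z = refl

Ex : PseudoBE
Ex = record
  { Carrier = Three ; _⇒_ = imp ; _⇝_ = imp ; one = top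
  ; refl⇒ = imp-refl ; refl⇝ = imp-refl ; top⇒ = imp-top ; top⇝ = imp-top
  ; left⇒ = λ _ → refl ; left⇝ = λ _ → refl ; exch = imp-exch
  ; one⇒⇝ = λ _ _ p → p ; one⇝⇒ = λ _ _ p → p }

-- a ∨ b = b but b ∨ a = a, so Ex is not commutative.
Ex-notCommutative : ¬ Commutative Ex
Ex-notCommutative (comm₁ , _) with comm₁ a b
... | ()

-- The joins of Ex are symmetric except on the pair {a, b}; there the
-- required identity μ b ⇒ μ b ≡ μ a ⇒ μ b is μ a ≤ μ b, which follows
-- from a ≤ b by monotonicity (and symmetrically for b ≤ a).
Ex-joinSymmetric₁ : ∀ μ → IS1 Ex μ → ∀ x y →
  imp (μ (imp (imp x y) y)) (μ y) ≡ imp (μ (imp (imp y x) x)) (μ y)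
Ex-joinSymmetric₁ μ mono top top = refl
Ex-joinSymmetric₁ μ mono top a   = refl
Ex-joinSymmetric₁ μ mono top b   = refl
Ex-joinSymmetric₁ μ mono a   top = refl
Ex-joinSymmetric₁ μ mono a   a   = refl
Ex-joinSymmetric₁ μ mono a   b   = trans (imp-refl (μ b)) (sym (mono a b refl))
Ex-joinSymmetric₁ μ mono b   top = refl
Ex-joinSymmetric₁ μ mono b   a   = trans (imp-refl (μ a)) (sym (mono b a refl))
Ex-joinSymmetric₁ μ mono b   b   = refl

-- Both arrows of Ex are imp, so one identity serves both joins.
Ex-joinSymmetric : ∀ μ → IS1 Ex μ → JoinSymmetric Ex μ
Ex-joinSymmetric μ mono x y =
  Ex-joinSymmetric₁ μ mono x y , Ex-joinSymmetric₁ μ mono x y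

proposition4p10 : ((A : PseudoBE) → Commutative A → SameStates A)
    × Σ PseudoBE (λ A → (¬ Commutative A) × SameStates A)
proposition4p10 =
  (λ A comm → sameStates-from-joinSymmetric A
                (λ μ _ → commutative⇒joinSymmetric A comm μ))
  , Ex , Ex-notCommutative , sameStates-from-joinSymmetric Ex Ex-joinSymmetric
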